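{- Let $m\geq 2$ and $r$ be positive integers, and let $\Delta:[1,g(m,r)-1]\to[1,r]$ be an $r$-coloring. If $|\Delta^{ -1}(c)\cap[1,r(m-1)]|\geq m$ for some $c\in[1,r]$, then $\Delta$ is not an $L(r)$-coloring (with respect to $m$).
   Context: For integers $a,b$, $[a,b]$ denotes the set of integers $i$ with $a\le i\le b$. For positive integers $m$ and $r$, $g(m,r)$ denotes the least positive integer $N$ such that for every map $\Delta:[1,N]\to[1,r]$ there exist $2m$ integers $x_1<\cdots<x_m<y_1<\cdots<y_m$ in $[1,N]$ with $\Delta(x_1)=\cdots=\Delta(x_m)$, $\Delta(y_1)=\cdots=\Delta(y_m)$, and $2(x_m-x_1)\leq y_m-x_1$. An $m$-set $Z=(z_1,\ldots,z_m)$ is a set of $m$ positive integers listed increasingly. For $m$-sets $X,Y$, write $X\prec Y$ if $x_m<y_1$. A set is monochromatic under $\Delta$ if $\Delta$ is constant on it. An $r$-coloring $\Delta:S\to[1,r]$ of a nonempty set $S$ of integers is an $L(r)$-coloring if there do not exist monochromatic $m$-sets $X,Y\subset S$ with $X\prec Y$ and $2(x_m-x_1)\leq y_m-x_1$. -}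

module Defs where

open import Data.Nat using (ℕ; zero; suc; _+_; _*_; _∸_; _≤_; _<_; _≤?_)
open import Data.Fin using (Fin; fromℕ) renaming (zero to fzero)
import Data.Fin as F
open import Data.List using (List; length; filter; map; upTo)
open import Data.Product using (Σ; _×_; ∃; ∃-syntax)
open import Data.Empty using (⊥)
open import Relation.Nullary using (¬_)
open import Relation.Binary.PropositionalEquality using (_≡_)

InRange : ℕ → ℕ → ℕ → Set
InRange a b i = a ≤ i × i ≤ b

-- An m-set with m = suc k: a strictly increasing map Fin (suc k) → ℕ.
StrictInc : {n : ℕ} → (Fin n → ℕ) → Set
StrictInc {n} z = ∀ (i j : Fin n) → i F.< j → z i < z j

Within : {n : ℕ} → (ℕ → Set) → (Fin n → ℕ) → Set
Within {n} S z = ∀ (i : Fin n) → S (z i)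

Mono : {n r : ℕ} → (ℕ → Fin r) → (Fin n → ℕ) → Set
Mono {n} Δ z = ∀ (i j : Fin n) → Δ (z i) ≡ Δ (z j)

-- Existence of monochromatic m-sets X ≺ Y in S with 2(x_m - x_1) ≤ y_m - x_1.
-- Only meaningful for m ≥ 1; for m = 0 we set it to ⊥ (never used: m ≥ 2).
BadPair : (m r : ℕ) → (S : ℕ → Set) → (ℕ → Fin r) → Set
BadPair zero    r S Δ = ⊥
BadPair (suc k) r S Δ =
  Σ (Fin (suc k) → ℕ) λ x → Σ (Fin (suc k) → ℕ) λ y →
    StrictInc x × StrictInc y × Within S x × Within S y ×
    Mono Δ x × Mono Δ y ×
    (x (fromℕ k) < y fzero) ×
    (2 * (x (fromℕ k) ∸ x fzero) ≤ y (fromℕ k) ∸ x fzero)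

IsLColoring : (m r : ℕ) → (S : ℕ → Set) → (ℕ → Fin r) → Set
IsLColoring m r S Δ = ¬ BadPair m r S Δ

-- Every r-coloring of [1,N] contains the pattern.
-- (A coloring of [1,N] is represented by any Δ : ℕ → Fin r; only its values on [1,N] matter.
--  Colors [1,r] are represented by Fin r.)
GoodN : (m r N : ℕ) → Set
GoodN m r N = ∀ (Δ : ℕ → Fin r) → BadPair m r (InRange 1 N) Δ

IsG : (m r N : ℕ) → Set
IsG m r N = 1 ≤ N × GoodN m r N × (∀ N' → 1 ≤ N' → N' < N → ¬ GoodN m r N')

countColor : {r : ℕ} → (ℕ → Fin r) → Fin r → ℕ → ℕ → ℕ
countColor Δ c M L =
  length (filter (λ i → Δ i F.≟ c) (filter (λ i → i ≤? M) (map suc (upTo L))))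

-- Let K = r(m-1). If c occurs m times in [1,K] ∩ [1,N-1], then, as [1,K] has only r(m-1) points,
-- some color d occurs at most m-2 times there. Color [1,N] by d at 1 and by Δ(i-1) at i ≥ 2; since
-- N = g(m,r) this coloring has a pair X ≺ Y. If x₁ ≥ 2, shifting X and Y down by one gives such a
-- pair for Δ. Otherwise X has color d, so x₂-1 < ... < x_m-1 are m-1 points of color d and hence
-- x_m - 1 > K; then the first m points of color c, all at most K, together with Y shifted down form
-- such a pair for Δ, because 2(x_m - 1) ≤ y_m - 1.

module Submission where

open import Defs
open import Data.Nat using (ℕ; _*_; _∸_; _≤_)
open import Data.Fin using (Fin)
open import Data.Product using (Σ)
open import Relation.Nullary using (¬_)

open import Data.Nat using (zero; suc; _+_; _<_; _≤?_; z≤n; s≤s)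
open import Data.Nat.Properties
open import Data.Fin as F using (fromℕ) renaming (zero to fzero; suc to fsuc)
import Data.Fin.Properties as FinP
open import Data.Bool using (Bool; true; false; if_then_else_)
open import Data.List using (List; []; _∷_; length; filter; map; upTo; lookup)
open import Data.List.Properties using (length-map; length-upTo)
open import Data.List.Membership.Propositional using (_∈_)
open import Data.List.Membership.Propositional.Properties
  using (∈-filter⁺; ∈-filter⁻; ∈-map⁺; ∈-map⁻; ∈-upTo⁺; ∈-upTo⁻; ∈-lookup)
open import Data.List.Membership.Setoid.Properties using (index-injective)
import Data.List.Relation.Unary.All as All
open import Data.List.Relation.Unary.AllPairs using (AllPairs; _∷_)
import Data.List.Relation.Unary.AllPairs as AllPairs
open import Data.List.Relation.Unary.AllPairs.Properties using (filter⁺; map⁺; applyUpTo⁺₁)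
open import Data.Product using (_×_; _,_; proj₁; proj₂; map₂)
open import Relation.Nullary using (Dec; does; yes; no; contradiction)
open import Relation.Binary using (Rel; tri<; tri≈; tri>)
open import Relation.Binary.PropositionalEquality
  using (_≡_; refl; sym; trans; cong; cong₂; subst; subst₂; setoid; module ≡-Reasoning; ≢-sym)
open import Function using (id; _∘_)
open import Function.Definitions using (Injective)
open import Algebra.Properties.CommutativeMonoid.Sum +-0-commutativeMonoid
  using (sum-syntax; ∑-distrib-+; sum-cong-≗; sum-replicate-zero)

private
  variable
    n k r K M : ℕ

strictInc-mono : {h : Fin n → ℕ} → StrictInc h → ∀ {i j} → i F.≤ j → h i ≤ h j
strictInc-mono h↗ {i} {j} i≤j with i F.≟ j
... | yes refl = ≤-refl
... | no i≢j = <⇒≤ (h↗ i j (FinP.≤∧≢⇒< i≤j i≢j))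

strictInc-injective : {h : Fin n → ℕ} → StrictInc h → Injective _≡_ _≡_ h
strictInc-injective h↗ {i} {j} hi≡hj with FinP.<-cmp i j
... | tri< i<j _ _ = contradiction hi≡hj (<⇒≢ (h↗ i j i<j))
... | tri≈ _ i≡j _ = i≡j
... | tri> _ _ j<i = contradiction hi≡hj (≢-sym (<⇒≢ (h↗ j i j<i)))

strictInc-∈⇒≤length : {h : Fin n → ℕ} {xs : List ℕ} → StrictInc h → (∀ i → h i ∈ xs) → n ≤ length xs
strictInc-∈⇒≤length h↗ h∈ =
  FinP.injective⇒≤ λ {i} {j} eq → strictInc-injective h↗ (index-injective (setoid ℕ) (h∈ i) (h∈ j) eq)

allPairs-lookup : ∀ {a ℓ} {A : Set a} {R : Rel A ℓ} {xs : List A} →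
  AllPairs R xs → ∀ {i j} → i F.< j → R (lookup xs i) (lookup xs j)
allPairs-lookup (Rx ∷ _) {fzero} {fsuc j} _ = All.lookup Rx (∈-lookup j)
allPairs-lookup (_ ∷ R↗) {fsuc i} {fsuc j} (s≤s i<j) = allPairs-lookup R↗ i<j

increasing-members : {xs : List ℕ} → AllPairs _<_ xs → n ≤ length xs →
  Σ (Fin n → ℕ) λ h → StrictInc h × (∀ i → h i ∈ xs)
increasing-members {xs = xs} xs↗ n≤ =
  (λ i → lookup xs (F.inject≤ i n≤)) ,
  (λ i j i<j → allPairs-lookup xs↗ (subst₂ _<_ (sym (FinP.toℕ-inject≤ i n≤)) (sym (FinP.toℕ-inject≤ j n≤)) i<j)) ,
  (λ i → ∈-lookup (F.inject≤ i n≤))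

window : ℕ → ℕ → List ℕ
window K M = filter (_≤? K) (map suc (upTo M))

window-increasing : AllPairs _<_ (window K M)
window-increasing {K} {M} =
  filter⁺ (_≤? K) (map⁺ (AllPairs.map s≤s (applyUpTo⁺₁ id M (λ i<j _ → i<j))))

∈-map-suc-upTo⁺ : ∀ {x} → 1 ≤ x → x ≤ M → x ∈ map suc (upTo M)
∈-map-suc-upTo⁺ {x = suc y} _ x≤M = ∈-map⁺ suc (∈-upTo⁺ x≤M)

∈-window⁺ : ∀ {x} → InRange 1 M x → x ≤ K → x ∈ window K M
∈-window⁺ {K = K} (1≤x , x≤M) x≤K = ∈-filter⁺ (_≤? K) (∈-map-suc-upTo⁺ 1≤x x≤M) x≤K

∈-window⁻ : ∀ {x} → x ∈ window K M → InRange 1 M x × x ≤ K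
∈-window⁻ {K} {M} x∈ with x∈map , x≤K ← ∈-filter⁻ (_≤? K) {xs = map suc (upTo M)} x∈
                     with y , y∈ , refl ← ∈-map⁻ suc x∈map = (s≤s z≤n , ∈-upTo⁻ y∈) , x≤K

length-window≤ : length (window K M) ≤ K
length-window≤ {K} {M} with h , h↗ , h∈ ← increasing-members (window-increasing {K} {M}) ≤-refl =
  subst (length (window K M) ≤_) (trans (length-map suc (upTo K)) (length-upTo K))
    (strictInc-∈⇒≤length h↗ λ i → let (1≤h , _) , h≤K = ∈-window⁻ {K} {M} (h∈ i) in ∈-map-suc-upTo⁺ 1≤h h≤K)

colorClass : (ℕ → Fin r) → Fin r → List ℕ → List ℕ
colorClass Δ c = filter (λ i → Δ i F.≟ c)

indicator : Bool → ℕ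
indicator b = if b then 1 else 0

length-filter-∷ : ∀ {a p} {A : Set a} {P : A → Set p} (P? : ∀ x → Dec (P x)) x xs →
  length (filter P? (x ∷ xs)) ≡ indicator (does (P? x)) + length (filter P? xs)
length-filter-∷ P? x xs with does (P? x)
... | true = refl
... | false = refl

∑-indicator≡1 : (e : Fin r) → ∑[ c < r ] indicator (does (e F.≟ c)) ≡ 1
∑-indicator≡1 {suc r} fzero = cong suc (sum-replicate-zero r)
∑-indicator≡1 {suc r} (fsuc e) = ∑-indicator≡1 e

∑-length-colorClass : (Δ : ℕ → Fin r) (xs : List ℕ) →
  ∑[ c < r ] length (colorClass Δ c xs) ≡ length xs
∑-length-colorClass {r} Δ [] = sum-replicate-zero r
∑-length-colorClass {r} Δ (x ∷ xs) = begin
  ∑[ c < r ] length (colorClass Δ c (x ∷ xs))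
    ≡⟨ sum-cong-≗ (λ c → length-filter-∷ (λ i → Δ i F.≟ c) x xs) ⟩
  ∑[ c < r ] (indicator (does (Δ x F.≟ c)) + length (colorClass Δ c xs))
    ≡⟨ ∑-distrib-+ (λ c → indicator (does (Δ x F.≟ c))) (λ c → length (colorClass Δ c xs)) ⟩
  ∑[ c < r ] indicator (does (Δ x F.≟ c)) + ∑[ c < r ] length (colorClass Δ c xs)
    ≡⟨ cong₂ _+_ (∑-indicator≡1 (Δ x)) (∑-length-colorClass Δ xs) ⟩
  suc (length xs) ∎
  where open ≡-Reasoning

*-≤-∑ : (f : Fin r → ℕ) → (∀ c → k ≤ f c) → r * k ≤ ∑[ c < r ] f c
*-≤-∑ {zero} f k≤f = z≤n
*-≤-∑ {suc r} f k≤f = +-mono-≤ (k≤f fzero) (*-≤-∑ (f ∘ fsuc) (k≤f ∘ fsuc))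

*-<-∑ : (f : Fin r → ℕ) → (∀ c → k ≤ f c) → ∀ c → k < f c → r * k < ∑[ c < r ] f c
*-<-∑ {suc r} f k≤f fzero k<f = +-mono-<-≤ k<f (*-≤-∑ (f ∘ fsuc) (k≤f ∘ fsuc))
*-<-∑ {suc r} f k≤f (fsuc c) k<f = +-mono-≤-< (k≤f fzero) (*-<-∑ (f ∘ fsuc) (k≤f ∘ fsuc) c k<f)

sparse-color : (Δ : ℕ → Fin r) {xs : List ℕ} → length xs ≤ r * k →
  ∀ c → k < length (colorClass Δ c xs) → Σ (Fin r) λ d → length (colorClass Δ d xs) < k
sparse-color {r} {k} Δ {xs} length≤ c dense =
  map₂ ≰⇒> (FinP.¬∀⟶∃¬ r (λ d → k ≤ length (colorClass Δ d xs)) (λ d → k ≤? _) all-large)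
  where
  all-large : ¬ (∀ d → k ≤ length (colorClass Δ d xs))
  all-large k≤ = <⇒≱ (subst (r * k <_) (∑-length-colorClass Δ xs)
                        (*-<-∑ (λ d → length (colorClass Δ d xs)) k≤ c dense)) length≤

prependColor : Fin r → (ℕ → Fin r) → ℕ → Fin r
prependColor d Δ (suc (suc i)) = Δ (suc i)
prependColor d Δ _ = d

prependColor-shift : ∀ {d : Fin r} {Δ : ℕ → Fin r} {i} → 2 ≤ i → prependColor d Δ i ≡ Δ (i ∸ 1)
prependColor-shift {i = suc (suc i)} _ = refl
prependColor-shift {i = suc zero} (s≤s ())

record MonoTuple {r : ℕ} (n : ℕ) (S : ℕ → Set) (Δ : ℕ → Fin r) : Set where
  constructor monoTuple
  field
    point      : Fin n → ℕ
    increasing : StrictInc point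
    within     : Within S point
    mono       : Mono Δ point

open MonoTuple

module _ {S : ℕ → Set} {Δ : ℕ → Fin r} where

  first : MonoTuple (suc n) S Δ → ℕ
  first X = point X fzero

  last : MonoTuple (suc n) S Δ → ℕ
  last {n} X = point X (fromℕ n)

  first≤ : (X : MonoTuple (suc n) S Δ) → ∀ i → first X ≤ point X i
  first≤ X i = strictInc-mono (increasing X) {fzero} {i} z≤n

  ≤last : (X : MonoTuple (suc n) S Δ) → ∀ i → point X i ≤ last X
  ≤last X i = strictInc-mono (increasing X) (FinP.≤fromℕ i)

  dropFirst : MonoTuple (suc n) S Δ → MonoTuple n S Δ
  dropFirst (monoTuple x x↗ x∈ x≡) =
    monoTuple (x ∘ fsuc) (λ i j i<j → x↗ (fsuc i) (fsuc j) (s≤s i<j)) (x∈ ∘ fsuc) (λ i j → x≡ (fsuc i) (fsuc j))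

  badPair : (X Y : MonoTuple (suc n) S Δ) → last X < first Y →
    2 * (last X ∸ first X) ≤ last Y ∸ first X → BadPair (suc n) r S Δ
  badPair X Y sep gap =
    point X , point Y , increasing X , increasing Y , within X , within Y , mono X , mono Y , sep , gap

shiftDown : {d : Fin r} {Δ : ℕ → Fin r} (X : MonoTuple n (InRange 1 (suc M)) (prependColor d Δ)) →
  (∀ i → 2 ≤ point X i) → MonoTuple n (InRange 1 M) Δ
shiftDown (monoTuple x x↗ x∈ x≡) 2≤x =
  monoTuple (λ i → x i ∸ 1)
    (λ i j i<j → ∸-monoˡ-< (x↗ i j i<j) (≤-trans (s≤s z≤n) (2≤x i)))
    (λ i → ∸-monoˡ-≤ 1 (2≤x i) , ∸-monoˡ-≤ 1 (proj₂ (x∈ i)))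
    (λ i j → trans (sym (prependColor-shift (2≤x i))) (trans (x≡ i j) (prependColor-shift (2≤x j))))

colorTuple : {Δ : ℕ → Fin r} {c : Fin r} → n ≤ length (colorClass Δ c (window K M)) →
  Σ (MonoTuple n (InRange 1 M) Δ) λ X → ∀ i → point X i ≤ K
colorTuple {K = K} {M} {Δ} {c} dense
  with h , h↗ , h∈ ← increasing-members (filter⁺ (λ i → Δ i F.≟ c) (window-increasing {K} {M})) dense =
  monoTuple h h↗ (proj₁ ∘ in-window) (λ i j → trans (colored i) (sym (colored j))) , proj₂ ∘ in-window
  where
  in-window : ∀ i → InRange 1 M (h i) × h i ≤ K
  in-window i = ∈-window⁻ {K} {M} (proj₁ (∈-filter⁻ (λ i → Δ i F.≟ c) (h∈ i)))
  colored : ∀ i → Δ (h i) ≡ c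
  colored i = proj₂ (∈-filter⁻ (λ i → Δ i F.≟ c) {xs = window K M} (h∈ i))

[m∸1]∸[n∸1]≡m∸n : ∀ m {n} → 1 ≤ n → (m ∸ 1) ∸ (n ∸ 1) ≡ m ∸ n
[m∸1]∸[n∸1]≡m∸n m {suc n} _ = ∸-+-assoc m 1 n

2*m≤n⇒2*[m∸o]≤n∸o : ∀ {m n} o → 2 * m ≤ n → 2 * (m ∸ o) ≤ n ∸ o
2*m≤n⇒2*[m∸o]≤n∸o {m} o 2m≤n =
  ≤-trans (≤-reflexive (*-distribˡ-∸ 2 m o)) (∸-mono 2m≤n (m≤m+n o (o + 0)))

module _ {d : Fin r} {Δ : ℕ → Fin r} (X Y : MonoTuple (suc k) (InRange 1 (suc M)) (prependColor d Δ))
         (sep : last X < first Y) (gap : 2 * (last X ∸ first X) ≤ last Y ∸ first X) where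

  private
    1≤first : 1 ≤ first X
    1≤first = proj₁ (within X fzero)

    1≤last : 1 ≤ last X
    1≤last = ≤-trans 1≤first (first≤ X (fromℕ k))

    2≤x⁺ : ∀ i → 2 ≤ point X (fsuc i)
    2≤x⁺ i = ≤-trans (s≤s 1≤first) (increasing X fzero (fsuc i) (s≤s z≤n))

    sep↓ : last X ∸ 1 < first Y ∸ 1
    sep↓ = ∸-monoˡ-< sep 1≤last

    Y↓ : MonoTuple (suc k) (InRange 1 M) Δ
    Y↓ = shiftDown Y (λ i → ≤-trans (s≤s 1≤last) (≤-trans sep (first≤ Y i)))

    badPair-shift : 2 ≤ first X → BadPair (suc k) r (InRange 1 M) Δ
    badPair-shift 2≤x₀ =
      badPair (shiftDown X (λ i → ≤-trans 2≤x₀ (first≤ X i))) Y↓ sep↓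
        (subst₂ (λ a b → 2 * a ≤ b)
          (sym ([m∸1]∸[n∸1]≡m∸n (last X) 1≤first)) (sym ([m∸1]∸[n∸1]≡m∸n (last Y) 1≤first)) gap)

    badPair-recolor : {c : Fin r} → first X ≡ 1 →
      length (colorClass Δ d (window K M)) < k → suc k ≤ length (colorClass Δ c (window K M)) →
      BadPair (suc k) r (InRange 1 M) Δ
    badPair-recolor {K} {c} x₀≡1 sparse dense =
      badPair P Y↓ (<-trans lastP<last↓ sep↓)
        (2*m≤n⇒2*[m∸o]≤n∸o (first P) (≤-trans (*-monoʳ-≤ 2 (<⇒≤ lastP<last↓)) gap₁))
      where
      gap₁ : 2 * (last X ∸ 1) ≤ last Y ∸ 1
      gap₁ = subst (λ a → 2 * (last X ∸ a) ≤ last Y ∸ a) x₀≡1 gap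

      X⁺ : MonoTuple k (InRange 1 M) Δ
      X⁺ = shiftDown (dropFirst X) 2≤x⁺

      colored-d : ∀ i → Δ (point X⁺ i) ≡ d
      colored-d i = begin
        Δ (point X (fsuc i) ∸ 1)           ≡⟨ sym (prependColor-shift (2≤x⁺ i)) ⟩
        prependColor d Δ (point X (fsuc i)) ≡⟨ mono X (fsuc i) fzero ⟩
        prependColor d Δ (first X)          ≡⟨ cong (prependColor d Δ) x₀≡1 ⟩
        d                                   ∎
        where open ≡-Reasoning

      K<last↓ : K < last X ∸ 1
      K<last↓ = ≰⇒> λ last↓≤K → <⇒≱ sparse (strictInc-∈⇒≤length (increasing X⁺) λ i →
        ∈-filter⁺ (λ j → Δ j F.≟ d)
          (∈-window⁺ (within X⁺ i) (≤-trans (∸-monoˡ-≤ 1 (≤last X (fsuc i))) last↓≤K)) (colored-d i))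

      denseTuple : Σ (MonoTuple (suc k) (InRange 1 M) Δ) λ P → ∀ i → point P i ≤ K
      denseTuple = colorTuple {K = K} {M = M} {c = c} dense

      P : MonoTuple (suc k) (InRange 1 M) Δ
      P = proj₁ denseTuple

      lastP<last↓ : last P < last X ∸ 1
      lastP<last↓ = ≤-<-trans (proj₂ denseTuple (fromℕ k)) K<last↓

  badPair-descend : {c : Fin r} →
    length (colorClass Δ d (window K M)) < k → suc k ≤ length (colorClass Δ c (window K M)) →
    BadPair (suc k) r (InRange 1 M) Δ
  badPair-descend sparse dense with 2 ≤? first X
  ... | yes 2≤x₀ = badPair-shift 2≤x₀
  ... | no 2≰x₀ = badPair-recolor (≤-antisym (≤-pred (≰⇒> 2≰x₀)) 1≤first) sparse dense

lemma4p1 : (m r N : ℕ) → 2 ≤ m → 1 ≤ r → IsG m r N →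
    (Δ : ℕ → Fin r) →
    Σ (Fin r) (λ c → m ≤ countColor Δ c (r * (m ∸ 1)) (N ∸ 1)) →
    ¬ IsLColoring m r (InRange 1 (N ∸ 1)) Δ
lemma4p1 (suc (suc k)) r (suc M) (s≤s (s≤s z≤n)) _ (s≤s z≤n , good , _) Δ (c , dense) isL
  with d , sparse ← sparse-color Δ {window (r * suc k) M} (length-window≤ {r * suc k} {M}) c dense
  with x , y , x↗ , y↗ , x∈ , y∈ , x≡ , y≡ , sep , gap ← good (prependColor d Δ) =
  isL (badPair-descend (monoTuple x x↗ x∈ x≡) (monoTuple y y↗ y∈ y≡) sep gap sparse dense)
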